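{- Let $(L,\vee,\wedge,0,1)$ be a complemented modular lattice and $a,b,c\in L$. Then $a\odot b\le c$ if and only if $a\le b\to c$.
   Context: A bounded lattice is complemented if every element $a$ has some $b$ with $a\vee b=1$, $a\wedge b=0$ (complements need not be unique); lattices are non-trivial. For $b\in L$, $b^+:=\{x\in L\mid b\vee x=1,\ b\wedge x=0\}$. Define $a\odot b:=\{b\wedge(a\vee x)\mid x\in b^+\}$ and $b\to c:=\{x\vee(b\wedge c)\mid x\in b^+\}$. For a set $A$ and an element $c$, $A\le c$ means $x\le c$ for all $x\in A$, and $a\le B$ means $a\le y$ for all $y\in B$. -}

module Defs where

open import Level using (_⊔_)
open import Data.Product using (Σ; _×_)
open import Relation.Nullary using (¬_)
open import Relation.Binary.Lattice.Bundles using (BoundedLattice)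

module _ {c ℓ₁ ℓ₂} (L : BoundedLattice c ℓ₁ ℓ₂) where
  open BoundedLattice L

  IsModular : Set (c ⊔ ℓ₁ ⊔ ℓ₂)
  IsModular = ∀ x y z → x ≤ z → (x ∨ (y ∧ z)) ≈ ((x ∨ y) ∧ z)

  Compl : Carrier → Carrier → Set ℓ₁
  Compl b x = ((b ∨ x) ≈ ⊤) × ((b ∧ x) ≈ ⊥)

  IsComplemented : Set (c ⊔ ℓ₁)
  IsComplemented = ∀ a → Σ Carrier (Compl a)

  IsNontrivial : Set ℓ₁
  IsNontrivial = ¬ (⊤ ≈ ⊥)

  _⊙∋_ : Carrier → Carrier → Carrier → Set (c ⊔ ℓ₁)
  (a ⊙∋ b) y = Σ Carrier (λ x → Compl b x × (y ≈ (b ∧ (a ∨ x))))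

  _⇒∋_ : Carrier → Carrier → Carrier → Set (c ⊔ ℓ₁)
  (b ⇒∋ d) y = Σ Carrier (λ x → Compl b x × (y ≈ (x ∨ (b ∧ d))))

  SetLe : (Carrier → Set (c ⊔ ℓ₁)) → Carrier → Set (c ⊔ ℓ₁ ⊔ ℓ₂)
  SetLe A d = ∀ y → A y → y ≤ d

  LeSet : Carrier → (Carrier → Set (c ⊔ ℓ₁)) → Set (c ⊔ ℓ₁ ⊔ ℓ₂)
  LeSet a B = ∀ y → B y → a ≤ y

-- Fix a complement x of b.  Modularity with b ∨ x ≈ ⊤ gives x ∨ (b ∧ (a ∨ x)) ≈ a ∨ x, and
-- modularity with b ∧ x ≈ ⊥ gives b ∧ (x ∨ (b ∧ d)) ≈ b ∧ d.  These two identities make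
-- y ↦ b ∧ (y ∨ x) and z ↦ x ∨ (b ∧ z) a Galois connection, so b ∧ (a ∨ x) ≤ d iff
-- a ≤ x ∨ (b ∧ d) for each x separately, and quantifying over x gives the theorem.
module Submission where

open import Defs
open import Data.Product using (_,_)
open import Function.Bundles using (_⇔_; mk⇔; Equivalence)
open import Relation.Binary.Lattice.Bundles using (BoundedLattice)
import Relation.Binary.Lattice.Properties.JoinSemilattice as JoinSemilatticeProperties
import Relation.Binary.Lattice.Properties.MeetSemilattice as MeetSemilatticeProperties
import Relation.Binary.Reasoning.PartialOrder as ≤-Reasoning
import Relation.Binary.Reasoning.Setoid as ≈-Reasoning

module ModularLattice {c ℓ₁ ℓ₂} (L : BoundedLattice c ℓ₁ ℓ₂) (modular : IsModular L) where
  open BoundedLattice L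
  open JoinSemilatticeProperties joinSemilattice using (∨-comm; ∨-cong; x≤y⇒x∨y≈y)
  open MeetSemilatticeProperties meetSemilattice using (∧-comm; ∧-cong; y≤x⇒x∧y≈y)

  ∨≈⊤⇒x∨[b∧y]≈y : ∀ {b x y} → (b ∨ x) ≈ ⊤ → x ≤ y → (x ∨ (b ∧ y)) ≈ y
  ∨≈⊤⇒x∨[b∧y]≈y {b} {x} {y} b∨x≈⊤ x≤y = begin
    x ∨ (b ∧ y)   ≈⟨ modular x b y x≤y ⟩
    (x ∨ b) ∧ y   ≈⟨ ∧-cong (Eq.trans (∨-comm x b) b∨x≈⊤) Eq.refl ⟩
    ⊤ ∧ y         ≈⟨ y≤x⇒x∧y≈y (maximum y) ⟩
    y             ∎
    where open ≈-Reasoning setoid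

  ∧≈⊥⇒b∧[x∨y]≈y : ∀ {b x y} → (b ∧ x) ≈ ⊥ → y ≤ b → (b ∧ (x ∨ y)) ≈ y
  ∧≈⊥⇒b∧[x∨y]≈y {b} {x} {y} b∧x≈⊥ y≤b = begin
    b ∧ (x ∨ y)   ≈⟨ ∧-comm b (x ∨ y) ⟩
    (x ∨ y) ∧ b   ≈⟨ ∧-cong (∨-comm x y) Eq.refl ⟩
    (y ∨ x) ∧ b   ≈⟨ Eq.sym (modular y x b y≤b) ⟩
    y ∨ (x ∧ b)   ≈⟨ ∨-cong Eq.refl (Eq.trans (∧-comm x b) b∧x≈⊥) ⟩
    y ∨ ⊥         ≈⟨ ∨-comm y ⊥ ⟩
    ⊥ ∨ y         ≈⟨ x≤y⇒x∨y≈y (minimum y) ⟩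
    y             ∎
    where open ≈-Reasoning setoid

  b∧[a∨x]≤d⇒a≤x∨[b∧d] : ∀ {a b d x} → (b ∨ x) ≈ ⊤ →
                        (b ∧ (a ∨ x)) ≤ d → a ≤ (x ∨ (b ∧ d))
  b∧[a∨x]≤d⇒a≤x∨[b∧d] {a} {b} {d} {x} b∨x≈⊤ b∧[a∨x]≤d = begin
    a                   ≤⟨ x≤x∨y a x ⟩
    a ∨ x               ≈⟨ Eq.sym (∨≈⊤⇒x∨[b∧y]≈y b∨x≈⊤ (y≤x∨y a x)) ⟩
    x ∨ (b ∧ (a ∨ x))   ≤⟨ ∨-least (x≤x∨y x _)
                             (trans (∧-greatest (x∧y≤x b (a ∨ x)) b∧[a∨x]≤d) (y≤x∨y x _)) ⟩
    x ∨ (b ∧ d)         ∎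
    where open ≤-Reasoning poset

  a≤x∨[b∧d]⇒b∧[a∨x]≤d : ∀ {a b d x} → (b ∧ x) ≈ ⊥ →
                        a ≤ (x ∨ (b ∧ d)) → (b ∧ (a ∨ x)) ≤ d
  a≤x∨[b∧d]⇒b∧[a∨x]≤d {a} {b} {d} {x} b∧x≈⊥ a≤x∨[b∧d] = begin
    b ∧ (a ∨ x)         ≤⟨ ∧-greatest (x∧y≤x b _)
                             (trans (x∧y≤y b _) (∨-least a≤x∨[b∧d] (x≤x∨y x _))) ⟩
    b ∧ (x ∨ (b ∧ d))   ≈⟨ ∧≈⊥⇒b∧[x∨y]≈y b∧x≈⊥ (x∧y≤x b d) ⟩
    b ∧ d               ≤⟨ x∧y≤y b d ⟩
    d                   ∎
    where open ≤-Reasoning poset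

  b∧[a∨x]≤d⇔a≤x∨[b∧d] : ∀ {a b d x} → Compl L b x →
                        (b ∧ (a ∨ x)) ≤ d ⇔ a ≤ (x ∨ (b ∧ d))
  b∧[a∨x]≤d⇔a≤x∨[b∧d] (b∨x≈⊤ , b∧x≈⊥) =
    mk⇔ (b∧[a∨x]≤d⇒a≤x∨[b∧d] b∨x≈⊤) (a≤x∨[b∧d]⇒b∧[a∨x]≤d b∧x≈⊥)

theorem4p3 : ∀ {c ℓ₁ ℓ₂} (L : BoundedLattice c ℓ₁ ℓ₂) →
    IsNontrivial L → IsModular L → IsComplemented L →
    ∀ a b d →
    SetLe L (_⊙∋_ L a b) d ⇔ LeSet L a (_⇒∋_ L b d)
theorem4p3 L _ modular _ a b d = mk⇔ forward backward
  where
  open BoundedLattice L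
  open ModularLattice L modular

  forward : SetLe L (_⊙∋_ L a b) d → LeSet L a (_⇒∋_ L b d)
  forward ⊙≤d y (x , x∈b⁺ , y≈) =
    ≤-respʳ-≈ (Eq.sym y≈) (Equivalence.to (b∧[a∨x]≤d⇔a≤x∨[b∧d] x∈b⁺) (⊙≤d _ (x , x∈b⁺ , Eq.refl)))

  backward : LeSet L a (_⇒∋_ L b d) → SetLe L (_⊙∋_ L a b) d
  backward a≤⇒ y (x , x∈b⁺ , y≈) =
    ≤-respˡ-≈ (Eq.sym y≈) (Equivalence.from (b∧[a∨x]≤d⇔a≤x∨[b∧d] x∈b⁺) (a≤⇒ _ (x , x∈b⁺ , Eq.refl)))
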